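{- For every positive integer $L$ and every integer $n\ge 0$, we have $a_2(L,n)\ge b_2(L,n)$.
   Context: A partition of $n$ is a non-increasing finite sequence $(\lambda_1,\lambda_2,\dots)$ of positive integers summing to $n$ (the empty partition is the unique partition of $0$); its largest part is $\lambda_1$. Its Young diagram has $\lambda_i$ left-justified cells in row $i$. If $\lambda'_j$ denotes the number of cells in column $j$, the hook length of the cell in row $i$, column $j$ is $h(i,j)=\lambda_i+\lambda'_j-i-j+1$. For a positive integer $L$: $a_2(L,n)$ is the total number of cells of hook length $2$, summed over all partitions of $n$ into odd parts with largest part at most $2L-1$; $b_2(L,n)$ is the total number of cells of hook length $2$, summed over all partitions of $n$ into distinct parts with largest part at most $L$. -}

module Defs where

open import Data.Nat using (ℕ; zero; suc; _+_; _*_; _∸_; _⊓_; _≤ᵇ_; _≡ᵇ_; _%_)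
open import Data.Bool using (Bool; true; false; _∧_; not; if_then_else_)
open import Data.List using (List; []; _∷_; map; concatMap; filterᵇ; length; applyUpTo)
open import Data.Nat.ListAction using (sum)
open import Data.Bool.ListAction using (all; any)

-- A partition is represented as the list (λ₁ , λ₂ , …) of its parts,
-- non-increasing, all positive.

range : ℕ → ℕ → List ℕ
range a b = applyUpTo (a +_) (suc b ∸ a)

-- parts f m n : all non-increasing lists of positive integers summing to n
-- whose entries are all ≤ m.  f is fuel (f ≥ n suffices, each part is ≥ 1).
parts : ℕ → ℕ → ℕ → List (List ℕ)
parts zero    m zero    = [] ∷ []
parts zero    m (suc n) = []
parts (suc f) m zero    = [] ∷ []
parts (suc f) m (suc n) =
  concatMap (λ k → map (k ∷_) (parts f k (suc n ∸ k))) (range 1 (m ⊓ suc n))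

partitions : ℕ → List (List ℕ)
partitions n = parts n n n

-- number of parts of a partition that are ≥ j, i.e. λ'_j (column length)
conj : List ℕ → ℕ → ℕ
conj λs j = length (filterᵇ (j ≤ᵇ_) λs)

-- hook length of cell (i , j) (1-indexed) of the Young diagram of λs:
-- h(i,j) = λ_i + λ'_j - i - j + 1, where λ_i = li is row i's length.
-- For a cell of the diagram, j ≤ λ_i and i ≤ λ'_j, so this equals
-- (λ_i ∸ j) + (λ'_j ∸ i) + 1 with no truncation.
hook : List ℕ → ℕ → ℕ → ℕ → ℕ
hook λs i li j = (li ∸ j) + (conj λs j ∸ i) + 1

cellsCount : ℕ → List ℕ → List ℕ → ℕ → ℕ
cellsCount h λs []        i = 0
cellsCount h λs (li ∷ r)  i =
  length (filterᵇ (λ j → hook λs i li j ≡ᵇ h) (range 1 li)) + cellsCount h λs r (suc i)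

hookCount : ℕ → List ℕ → ℕ
hookCount h λs = cellsCount h λs λs 1

isOdd : ℕ → Bool
isOdd k = k % 2 ≡ᵇ 1

distinctᵇ : List ℕ → Bool
distinctᵇ []       = true
distinctᵇ (x ∷ xs) = not (any (x ≡ᵇ_) xs) ∧ distinctᵇ xs

largest : List ℕ → ℕ
largest []      = 0
largest (x ∷ _) = x

oddPartitions : ℕ → ℕ → List (List ℕ)
oddPartitions L n =
  filterᵇ (λ λs → all isOdd λs ∧ (largest λs ≤ᵇ 2 * L ∸ 1)) (partitions n)

distinctPartitions : ℕ → ℕ → List (List ℕ)
distinctPartitions L n =
  filterᵇ (λ λs → distinctᵇ λs ∧ (largest λs ≤ᵇ L)) (partitions n)

a₂ : ℕ → ℕ → ℕ
a₂ L n = sum (map (hookCount 2) (oddPartitions L n))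

b₂ : ℕ → ℕ → ℕ
b₂ L n = sum (map (hookCount 2) (distinctPartitions L n))

-- Let O_L and D_L be the generating functions of partitions into odd parts ≤ 2L - 1 and into
-- distinct parts ≤ L, and A_L and B_L the generating functions of their cells of hook length 2,
-- so that a₂ and b₂ are the coefficients of A_L and B_L. Removing the largest part gives
-- recurrences in which the new cells of hook length 2 all lie in the first row, and these
-- recurrences solve to
--   O_L     = D_L ∏_{L<j≤2L} 1/(1 - q^j)                        (finite Euler identity),
--   A_L     = (Σ_{k<L} q^(2(2k+1)) + Σ_{1≤k<L} q^(2k+1)) O_L,
--   B_(L+1) = (q^2 + ⋯ + q^(L+1)) ∏_{2≤j≤L} (1 + q^j).
-- Coefficientwise, q^2 + ⋯ + q^(L+1) ≤ (1 + q)(q^2 + q^3 + q^5 + ⋯ + q^(2L+1)) and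
-- (1 + q) ∏_{2≤j≤L} (1 + q^j) ≤ D_(L+1) ≤ O_(L+1), hence B_(L+1) ≤ A_(L+1).

module Submission where

open import Defs
open import Data.Nat using (ℕ; zero; suc; _+_; _*_; _∸_; _≤_; _<_; _≥_; _≤′_; ≤′-refl; ≤′-step; z≤n; s≤s; _⊓_; _⊔_; _≤ᵇ_; _≡ᵇ_)
open import Data.Nat.Properties
open import Data.Nat.Induction using (<-rec)
open import Data.Nat.ListAction using (sum)
open import Data.Nat.ListAction.Properties using (sum-++)
open import Data.Bool using (Bool; true; false; _∧_; _∨_; not)
open import Data.Bool.Properties using (not-involutive; T-≡)
open import Data.Bool.ListAction using (all; any)
open import Data.List using (List; []; _∷_; map; concatMap; filterᵇ; length; applyUpTo; [_]; _++_)
open import Data.List.Properties using (map-++; map-∘; map-cong; concatMap-cong; applyUpTo-∷ʳ)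
open import Data.List.Relation.Unary.All as All using (All; []; _∷_)
open import Data.Sum using (inj₁; inj₂)
open import Function using (_∘_; _∘′_)
open import Function.Bundles using (Equivalence)
open import Level using (0ℓ)
open import Algebra.Bundles using (CommutativeMonoid)
import Algebra.Construct.Pointwise as Pointwise
open import Algebra.Properties.CommutativeSemigroup +-commutativeSemigroup using () renaming (interchange to +-interchange)
open import Relation.Binary.Bundles using (Preorder)
import Relation.Binary.Reasoning.Preorder
open import Relation.Binary.PropositionalEquality hiding ([_])
open import Relation.Nullary using (yes; no; contradiction)

-- Formal power series with natural coefficients

Series : Set
Series = ℕ → ℕ

Op : Set
Op = Series → Series

infix  4 _≤ₛ_
infixl 6 _⊕_
infixr 7 q^_·_ [1+q^_]·_ [1-q^1+_]⁻¹·_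

_⊕_ : Series → Series → Series
(f ⊕ g) n = f n + g n

𝟘 𝟙 : Series
𝟘 n = 0
𝟙 zero    = 1
𝟙 (suc n) = 0

_≤ₛ_ : Series → Series → Set
f ≤ₛ g = ∀ n → f n ≤ g n

⊕-commutativeMonoid : CommutativeMonoid 0ℓ 0ℓ
⊕-commutativeMonoid = record
  { Carrier             = Series
  ; _≈_                 = _≗_
  ; _∙_                 = _⊕_
  ; ε                   = 𝟘
  ; isCommutativeMonoid = Pointwise.isCommutativeMonoid ℕ +-0-isCommutativeMonoid
  }

open CommutativeMonoid ⊕-commutativeMonoid
  using () renaming (isEquivalence to ≗-isEquivalence; assoc to ⊕-assoc; comm to ⊕-comm)

≤ₛ-preorder : Preorder 0ℓ 0ℓ 0ℓ
≤ₛ-preorder = record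
  { Carrier    = Series
  ; _≈_        = _≗_
  ; _≲_        = _≤ₛ_
  ; isPreorder = record
    { isEquivalence = ≗-isEquivalence
    ; reflexive     = λ f≗g n → ≤-reflexive (f≗g n)
    ; trans         = λ f≤g g≤h n → ≤-trans (f≤g n) (g≤h n)
    }
  }

open Preorder ≤ₛ-preorder using () renaming (refl to ≤ₛ-refl; trans to ≤ₛ-trans)
module ≗ = Preorder.Eq ≤ₛ-preorder
module ≤ₛ-Reasoning = Relation.Binary.Reasoning.Preorder ≤ₛ-preorder
open import Algebra.Properties.CommutativeSemigroup (CommutativeMonoid.commutativeSemigroup ⊕-commutativeMonoid)
  using (interchange)

⊕-cong : ∀ {f f′ g g′} → f ≗ f′ → g ≗ g′ → f ⊕ g ≗ f′ ⊕ g′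
⊕-cong f≗f′ g≗g′ n = cong₂ _+_ (f≗f′ n) (g≗g′ n)

⊕-congˡ : ∀ {f g g′} → g ≗ g′ → f ⊕ g ≗ f ⊕ g′
⊕-congˡ = ⊕-cong (λ _ → refl)

⊕-congʳ : ∀ {f f′ g} → f ≗ f′ → f ⊕ g ≗ f′ ⊕ g
⊕-congʳ f≗f′ = ⊕-cong f≗f′ (λ _ → refl)

⊕-mono : ∀ {f f′ g g′} → f ≤ₛ f′ → g ≤ₛ g′ → f ⊕ g ≤ₛ f′ ⊕ g′
⊕-mono f≤f′ g≤g′ n = +-mono-≤ (f≤f′ n) (g≤g′ n)

q^_·_ : ℕ → Series → Series
(q^ zero  · f) n       = f n
(q^ suc a · f) zero    = 0
(q^ suc a · f) (suc n) = (q^ a · f) n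

[1+q^_]·_ : ℕ → Series → Series
[1+q^ p ]· f = f ⊕ q^ p · f

index-cong : ∀ (F : ℕ → Series) {a b} → a ≡ b → F a ≗ F b
index-cong F refl _ = refl

q^-coeff-≥ : ∀ a f {n} → a ≤ n → (q^ a · f) n ≡ f (n ∸ a)
q^-coeff-≥ zero    f a≤n       = refl
q^-coeff-≥ (suc a) f (s≤s a≤n) = q^-coeff-≥ a f a≤n

q^-coeff-< : ∀ a f {n} → n < a → (q^ a · f) n ≡ 0
q^-coeff-< (suc a) f {zero}  _         = refl
q^-coeff-< (suc a) f {suc n} (s≤s n<a) = q^-coeff-< a f n<a

q^-cong : ∀ a {f g} → f ≗ g → q^ a · f ≗ q^ a · g
q^-cong zero    f≗g n       = f≗g n
q^-cong (suc a) f≗g zero    = refl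
q^-cong (suc a) f≗g (suc n) = q^-cong a f≗g n

q^-⊕ : ∀ a f g → q^ a · (f ⊕ g) ≗ q^ a · f ⊕ q^ a · g
q^-⊕ zero    f g n       = refl
q^-⊕ (suc a) f g zero    = refl
q^-⊕ (suc a) f g (suc n) = q^-⊕ a f g n

q^-𝟘 : ∀ a → q^ a · 𝟘 ≗ 𝟘
q^-𝟘 zero    n       = refl
q^-𝟘 (suc a) zero    = refl
q^-𝟘 (suc a) (suc n) = q^-𝟘 a n

q^-q^ : ∀ a b f → q^ a · q^ b · f ≗ q^ (a + b) · f
q^-q^ zero    b f n       = refl
q^-q^ (suc a) b f zero    = refl
q^-q^ (suc a) b f (suc n) = q^-q^ a b f n

q^-comm : ∀ a b f → q^ a · q^ b · f ≗ q^ b · q^ a · f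
q^-comm a b f = begin-equality
  q^ a · q^ b · f  ≈⟨ q^-q^ a b f ⟩
  q^ (a + b) · f   ≈⟨ index-cong (q^_· f) (+-comm a b) ⟩
  q^ (b + a) · f   ≈⟨ q^-q^ b a f ⟨
  q^ b · q^ a · f  ∎
  where open ≤ₛ-Reasoning

q^suc-causal : ∀ a {g h} n → (∀ {m} → m < n → g m ≡ h m) → (q^ suc a · g) n ≡ (q^ suc a · h) n
q^suc-causal a       zero    g≡h = refl
q^suc-causal zero    (suc n) g≡h = g≡h ≤-refl
q^suc-causal (suc a) (suc n) g≡h = q^suc-causal a n (λ m<n → g≡h (m≤n⇒m≤1+n m<n))

q^suc-fixpoint-unique : ∀ a {f g h} → g ≗ f ⊕ q^ suc a · g → h ≗ f ⊕ q^ suc a · h → g ≗ h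
q^suc-fixpoint-unique a {f} {g} {h} g-fix h-fix = <-rec (λ n → g n ≡ h n) λ n g≡h →
  trans (g-fix n) (trans (cong (f n +_) (q^suc-causal a n g≡h)) (sym (h-fix n)))

private
  geomUpTo : ℕ → ℕ → Series → Series
  geomUpTo zero    a f = f
  geomUpTo (suc k) a f = f ⊕ q^ suc a · geomUpTo k a f

  geomUpTo-stable : ∀ a f {k l n} → n ≤ k → n ≤ l → geomUpTo k a f n ≡ geomUpTo l a f n
  geomUpTo-stable a f {zero}  {zero}  z≤n z≤n = refl
  geomUpTo-stable a f {zero}  {suc l} z≤n _   = sym (+-identityʳ (f 0))
  geomUpTo-stable a f {suc k} {zero}  _   z≤n = +-identityʳ (f 0)
  geomUpTo-stable a f {suc k} {suc l} {n} n≤k n≤l = cong (f n +_) (q^suc-causal a n λ m<n →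
    geomUpTo-stable a f (≤-pred (≤-trans m<n n≤k)) (≤-pred (≤-trans m<n n≤l)))

-- f / (1 - q^(1+a)), read off from the partial sums f (1 + q^(1+a) + ⋯ + q^(k(1+a))), exact up to q^k
[1-q^1+_]⁻¹·_ : ℕ → Series → Series
([1-q^1+ a ]⁻¹· f) n = geomUpTo n a f n

geom-unfold : ∀ a f → [1-q^1+ a ]⁻¹· f ≗ f ⊕ q^ suc a · [1-q^1+ a ]⁻¹· f
geom-unfold a f zero    = sym (+-identityʳ (f 0))
geom-unfold a f (suc n) = cong (f (suc n) +_) (q^suc-causal a (suc n) λ {m} m<n →
  geomUpTo-stable a f (≤-pred m<n) ≤-refl)

geom-unique : ∀ a {f h} → h ≗ f ⊕ q^ suc a · h → h ≗ [1-q^1+ a ]⁻¹· f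
geom-unique a {f} h-fix = q^suc-fixpoint-unique a h-fix (geom-unfold a f)

geom-inflationary : ∀ a f → f ≤ₛ [1-q^1+ a ]⁻¹· f
geom-inflationary a f n = subst (f n ≤_) (sym (geom-unfold a f n)) (m≤m+n _ _)

-- Multiplication f ↦ h · f by a fixed series h. Such operators commute with 1 + q^p and,
-- by uniqueness of fixed points, with 1/(1 - q^(1+a)).
record IsMultiplier (T : Op) : Set where
  field
    ≗-cong  : ∀ {f g} → f ≗ g → T f ≗ T g
    ⊕-hom   : ∀ f g → T (f ⊕ g) ≗ T f ⊕ T g
    q^-hom  : ∀ a f → T (q^ a · f) ≗ q^ a · T f

  mono : ∀ {f g} → f ≤ₛ g → T f ≤ₛ T g
  mono {f} {g} f≤g n = begin
    T f n          ≤⟨ m≤m+n (T f n) (T d n) ⟩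
    T f n + T d n  ≡⟨ ⊕-hom f d n ⟨
    T (f ⊕ d) n    ≡⟨ ≗-cong (λ m → m+[n∸m]≡n (f≤g m)) n ⟩
    T g n          ∎
    where
    open ≤-Reasoning
    d : Series
    d m = g m ∸ f m

  [1+q^]-comm : ∀ p f → T ([1+q^ p ]· f) ≗ [1+q^ p ]· T f
  [1+q^]-comm p f = ≗.trans (⊕-hom f (q^ p · f)) (⊕-congˡ (q^-hom p f))

  geom-comm : ∀ a f → T ([1-q^1+ a ]⁻¹· f) ≗ [1-q^1+ a ]⁻¹· T f
  geom-comm a f = geom-unique a (begin-equality
    T g                        ≈⟨ ≗-cong (geom-unfold a f) ⟩
    T (f ⊕ q^ suc a · g)       ≈⟨ ⊕-hom f (q^ suc a · g) ⟩
    T f ⊕ T (q^ suc a · g)     ≈⟨ ⊕-congˡ (q^-hom (suc a) g) ⟩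
    T f ⊕ q^ suc a · T g       ∎)
    where
    open ≤ₛ-Reasoning
    g = [1-q^1+ a ]⁻¹· f

open IsMultiplier

_⊞_ : Op → Op → Op
(S ⊞ T) f = S f ⊕ T f

id-isMultiplier : IsMultiplier (λ f → f)
id-isMultiplier = record { ≗-cong = λ f≗g → f≗g ; ⊕-hom = λ _ _ → ≗.refl ; q^-hom = λ _ _ → ≗.refl }

𝟘-isMultiplier : IsMultiplier (λ _ → 𝟘)
𝟘-isMultiplier = record { ≗-cong = λ _ → ≗.refl ; ⊕-hom = λ _ _ → ≗.refl ; q^-hom = λ a _ → ≗.sym (q^-𝟘 a) }

∘-isMultiplier : ∀ {S T} → IsMultiplier S → IsMultiplier T → IsMultiplier (λ f → S (T f))
∘-isMultiplier {S} {T} S-mul T-mul = record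
  { ≗-cong  = λ f≗g → ≗-cong S-mul (≗-cong T-mul f≗g)
  ; ⊕-hom   = λ f g → ≗.trans (≗-cong S-mul (⊕-hom T-mul f g)) (⊕-hom S-mul (T f) (T g))
  ; q^-hom  = λ a f → ≗.trans (≗-cong S-mul (q^-hom T-mul a f)) (q^-hom S-mul a (T f))
  }

⊞-isMultiplier : ∀ {S T} → IsMultiplier S → IsMultiplier T → IsMultiplier (S ⊞ T)
⊞-isMultiplier {S} {T} S-mul T-mul = record
  { ≗-cong  = λ f≗g → ⊕-cong (≗-cong S-mul f≗g) (≗-cong T-mul f≗g)
  ; ⊕-hom   = λ f g → ≗.trans (⊕-cong (⊕-hom S-mul f g) (⊕-hom T-mul f g)) (interchange (S f) (S g) (T f) (T g))
  ; q^-hom  = λ a f → ≗.trans (⊕-cong (q^-hom S-mul a f) (q^-hom T-mul a f)) (≗.sym (q^-⊕ a (S f) (T f)))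
  }

q^-isMultiplier : ∀ a → IsMultiplier (q^ a ·_)
q^-isMultiplier a = record { ≗-cong = q^-cong a ; ⊕-hom = q^-⊕ a ; q^-hom = λ b f → q^-comm a b f }

[1+q^]-isMultiplier : ∀ p → IsMultiplier ([1+q^ p ]·_)
[1+q^]-isMultiplier p = ⊞-isMultiplier id-isMultiplier (q^-isMultiplier p)

geom-isMultiplier : ∀ a → IsMultiplier ([1-q^1+ a ]⁻¹·_)
geom-isMultiplier a = record
  { ≗-cong  = λ {f} f≗g → geom-unique a (≗.trans (geom-unfold a f) (⊕-congʳ f≗g))
  ; ⊕-hom   = λ f g → ≗.sym (geom-unique a (begin-equality
      G f ⊕ G g                                          ≈⟨ ⊕-cong (geom-unfold a f) (geom-unfold a g) ⟩
      (f ⊕ q^ suc a · G f) ⊕ (g ⊕ q^ suc a · G g)       ≈⟨ interchange f _ g _ ⟩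
      (f ⊕ g) ⊕ (q^ suc a · G f ⊕ q^ suc a · G g)       ≈⟨ ⊕-congˡ (q^-⊕ (suc a) (G f) (G g)) ⟨
      (f ⊕ g) ⊕ q^ suc a · (G f ⊕ G g)                  ∎))
  ; q^-hom  = λ b f → ≗.sym (geom-unique a (begin-equality
      q^ b · G f                                  ≈⟨ q^-cong b (geom-unfold a f) ⟩
      q^ b · (f ⊕ q^ suc a · G f)                 ≈⟨ q^-⊕ b f _ ⟩
      q^ b · f ⊕ q^ b · q^ suc a · G f            ≈⟨ ⊕-congˡ (q^-comm b (suc a) (G f)) ⟩
      q^ b · f ⊕ q^ suc a · q^ b · G f            ∎))
  }
  where
  open ≤ₛ-Reasoning
  G = [1-q^1+ a ]⁻¹·_

-- Finite products and Euler's identity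

product : (ℕ → Op) → ℕ → ℕ → Op
product T a zero    f = f
product T a (suc k) f = T (a + k) (product T a k f)

product-inflationary : ∀ {T} → (∀ j f → f ≤ₛ T j f) → ∀ a k f → f ≤ₛ product T a k f
product-inflationary T-infl a zero    f = ≤ₛ-refl
product-inflationary T-infl a (suc k) f = ≤ₛ-trans (product-inflationary T-infl a k f) (T-infl (a + k) _)

module _ {T : ℕ → Op} (T-mul : ∀ j → IsMultiplier (T j)) where

  product-isMultiplier : ∀ a k → IsMultiplier (product T a k)
  product-isMultiplier a zero    = id-isMultiplier
  product-isMultiplier a (suc k) = ∘-isMultiplier (T-mul (a + k)) (product-isMultiplier a k)

  product-peel : (∀ i j f → T i (T j f) ≗ T j (T i f)) →
                 ∀ a k f → product T a (suc k) f ≗ T a (product T (suc a) k f)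
  product-peel T-comm a zero    f = index-cong (λ j → T j f) (+-identityʳ a)
  product-peel T-comm a (suc k) f = begin-equality
    T (a + suc k) (product T a (suc k) f)        ≈⟨ ≗-cong (T-mul _) (product-peel T-comm a k f) ⟩
    T (a + suc k) (T a (product T (suc a) k f))  ≈⟨ T-comm (a + suc k) a _ ⟩
    T a (T (a + suc k) (product T (suc a) k f))  ≈⟨ ≗-cong (T-mul a) (index-cong (λ j → T j (product T (suc a) k f)) (+-suc a k)) ⟩
    T a (T (suc a + k) (product T (suc a) k f))  ∎
    where open ≤ₛ-Reasoning

-- ∏ (1 + q^j) over a < j ≤ a + k
∏[1+q^j] : ℕ → ℕ → Op
∏[1+q^j] = product (λ j → [1+q^ suc j ]·_)

-- ∏ 1/(1 - q^j) over a < j ≤ a + k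
∏[1-q^j]⁻¹ : ℕ → ℕ → Op
∏[1-q^j]⁻¹ = product [1-q^1+_]⁻¹·_

-- ∏ 1/(1 - q^(2j-1)) over 1 ≤ j ≤ L
∏[1-q^odd]⁻¹ : ℕ → Op
∏[1-q^odd]⁻¹ = product (λ j → [1-q^1+ (j + j) ]⁻¹·_) 0

∏[1+q^j]-isMultiplier : ∀ a k → IsMultiplier (∏[1+q^j] a k)
∏[1+q^j]-isMultiplier = product-isMultiplier (λ j → [1+q^]-isMultiplier (suc j))

∏[1+q^j]-peel : ∀ a k f → ∏[1+q^j] a (suc k) f ≗ [1+q^ suc a ]· ∏[1+q^j] (suc a) k f
∏[1+q^j]-peel = product-peel (λ j → [1+q^]-isMultiplier (suc j))
  (λ i j → [1+q^]-comm ([1+q^]-isMultiplier (suc i)) (suc j))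

[1+q^]-geom-double : ∀ a f → [1+q^ suc a ]· [1-q^1+ (a + suc a) ]⁻¹· f ≗ [1-q^1+ a ]⁻¹· f
[1+q^]-geom-double a f = geom-unique a (begin-equality
  g ⊕ q^ p · g                          ≈⟨ ⊕-congʳ (geom-unfold (a + p) f) ⟩
  f ⊕ q^ (p + p) · g ⊕ q^ p · g         ≈⟨ ⊕-assoc f _ _ ⟩
  f ⊕ (q^ (p + p) · g ⊕ q^ p · g)       ≈⟨ ⊕-congˡ {f} (⊕-comm (q^ (p + p) · g) _) ⟩
  f ⊕ (q^ p · g ⊕ q^ (p + p) · g)       ≈⟨ ⊕-congˡ {f} (⊕-congˡ {q^ p · g} (q^-q^ p p g)) ⟨
  f ⊕ (q^ p · g ⊕ q^ p · q^ p · g)      ≈⟨ ⊕-congˡ (q^-⊕ p g (q^ p · g)) ⟨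
  f ⊕ q^ p · [1+q^ p ]· g               ∎)
  where
  open ≤ₛ-Reasoning
  p = suc a
  g = [1-q^1+ (a + p) ]⁻¹· f

∏[1-q^j]⁻¹-shift : ∀ L f → ∏[1-q^j]⁻¹ L (suc L) f ≗ [1+q^ suc L ]· ∏[1-q^j]⁻¹ (suc L) (suc L) f
∏[1-q^j]⁻¹-shift L f = begin-equality
  ∏[1-q^j]⁻¹ L (suc L) f                                          ≈⟨ geom-peel ⟩
  [1-q^1+ L ]⁻¹· ∏[1-q^j]⁻¹ (suc L) L f                            ≈⟨ [1+q^]-geom-double L _ ⟨
  [1+q^ suc L ]· [1-q^1+ (L + suc L) ]⁻¹· ∏[1-q^j]⁻¹ (suc L) L f   ≈⟨ reindex ⟩
  [1+q^ suc L ]· ∏[1-q^j]⁻¹ (suc L) (suc L) f                      ∎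
  where
  open ≤ₛ-Reasoning
  geom-peel = product-peel geom-isMultiplier (λ i j → geom-comm (geom-isMultiplier i) j) L L f
  reindex = ≗-cong ([1+q^]-isMultiplier (suc L)) (index-cong ([1-q^1+_]⁻¹· ∏[1-q^j]⁻¹ (suc L) L f) (+-suc L L))

∏[1-q^odd]⁻¹-euler : ∀ L f → ∏[1-q^odd]⁻¹ L f ≗ ∏[1+q^j] 0 L (∏[1-q^j]⁻¹ L L f)
∏[1-q^odd]⁻¹-euler zero    f = ≗.refl
∏[1-q^odd]⁻¹-euler (suc L) f = begin-equality
  [1-q^1+ (L + L) ]⁻¹· ∏[1-q^odd]⁻¹ L f                        ≈⟨ ≗-cong (geom-isMultiplier (L + L)) (∏[1-q^odd]⁻¹-euler L f) ⟩
  [1-q^1+ (L + L) ]⁻¹· P (∏[1-q^j]⁻¹ L L f)                    ≈⟨ geom-comm P-mul (L + L) _ ⟨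
  P (∏[1-q^j]⁻¹ L (suc L) f)                                   ≈⟨ ≗-cong P-mul (∏[1-q^j]⁻¹-shift L f) ⟩
  P ([1+q^ suc L ]· ∏[1-q^j]⁻¹ (suc L) (suc L) f)              ≈⟨ [1+q^]-comm P-mul (suc L) _ ⟩
  [1+q^ suc L ]· P (∏[1-q^j]⁻¹ (suc L) (suc L) f)              ∎
  where
  open ≤ₛ-Reasoning
  P = ∏[1+q^j] 0 L
  P-mul = ∏[1+q^j]-isMultiplier 0 L

∏[1+q^j]≤∏[1-q^odd]⁻¹ : ∀ L f → ∏[1+q^j] 0 L f ≤ₛ ∏[1-q^odd]⁻¹ L f
∏[1+q^j]≤∏[1-q^odd]⁻¹ L f = begin
  ∏[1+q^j] 0 L f                        ≲⟨ mono (∏[1+q^j]-isMultiplier 0 L) (product-inflationary geom-inflationary L L f) ⟩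
  ∏[1+q^j] 0 L (∏[1-q^j]⁻¹ L L f)       ≈⟨ ∏[1-q^odd]⁻¹-euler L f ⟨
  ∏[1-q^odd]⁻¹ L f                      ∎
  where open ≤ₛ-Reasoning

Σq^ : ℕ → ℕ → Op
Σq^ c zero    f = 𝟘
Σq^ c (suc k) f = Σq^ c k f ⊕ q^ (c + k) · f

Σq^-isMultiplier : ∀ c k → IsMultiplier (Σq^ c k)
Σq^-isMultiplier c zero    = 𝟘-isMultiplier
Σq^-isMultiplier c (suc k) = ⊞-isMultiplier (Σq^-isMultiplier c k) (q^-isMultiplier (c + k))

Σq^-mono-length : ∀ c {k k′} f → k ≤ k′ → Σq^ c k f ≤ₛ Σq^ c k′ f
Σq^-mono-length c {k} f k≤k′ = go (≤⇒≤′ k≤k′)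
  where
  go : ∀ {k′} → k ≤′ k′ → Σq^ c k f ≤ₛ Σq^ c k′ f
  go ≤′-refl           = ≤ₛ-refl
  go (≤′-step k≤′k′) n = ≤-trans (go k≤′k′ n) (m≤m+n _ _)

Σq^-suc : ∀ c k f → Σq^ (suc c) k f ≗ q^ 1 · Σq^ c k f
Σq^-suc c zero    f = ≗.sym (q^-𝟘 1)
Σq^-suc c (suc k) f = ≗.trans (⊕-cong (Σq^-suc c k f) (≗.sym (q^-q^ 1 (c + k) f))) (≗.sym (q^-⊕ 1 _ _))

Σq^-∷ : ∀ c k f → Σq^ c (suc k) f ≗ q^ c · f ⊕ Σq^ (suc c) k f
Σq^-∷ c zero    f = ≗.trans (⊕-comm 𝟘 (q^ (c + 0) · f)) (⊕-congʳ (index-cong (q^_· f) (+-identityʳ c)))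
Σq^-∷ c (suc k) f = begin-equality
  Σq^ c (suc k) f ⊕ q^ (c + suc k) · f                ≈⟨ ⊕-cong (Σq^-∷ c k f) (index-cong (q^_· f) (+-suc c k)) ⟩
  q^ c · f ⊕ Σq^ (suc c) k f ⊕ q^ (suc c + k) · f      ≈⟨ ⊕-assoc (q^ c · f) _ _ ⟩
  q^ c · f ⊕ Σq^ (suc c) (suc k) f                    ∎
  where open ≤ₛ-Reasoning

Σq^₂-[1+q^] : ∀ j f → Σq^ 2 (suc j) ([1+q^ suc j ]· f) ≗ Σq^ 2 j f ⊕ q^ (2 + j) · ([1+q^ 1 ]· f ⊕ Σq^ 2 j f)
Σq^₂-[1+q^] j f = begin-equality
  Σq^ 2 (suc j) ([1+q^ suc j ]· f)                                  ≈⟨ [1+q^]-comm (Σq^-isMultiplier 2 (suc j)) (suc j) f ⟩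
  (Σq^ 2 j f ⊕ q^ (2 + j) · f) ⊕ q^ suc j · Σq^ 2 (suc j) f         ≈⟨ ⊕-congˡ {Σq^ 2 j f ⊕ q^ (2 + j) · f} top ⟩
  (Σq^ 2 j f ⊕ q^ (2 + j) · f) ⊕ q^ (2 + j) · (q^ 1 · f ⊕ Σ)         ≈⟨ ⊕-assoc (Σq^ 2 j f) _ _ ⟩
  Σq^ 2 j f ⊕ (q^ (2 + j) · f ⊕ q^ (2 + j) · (q^ 1 · f ⊕ Σ))         ≈⟨ ⊕-congˡ {Σq^ 2 j f} (q^-⊕ (2 + j) f _) ⟨
  Σq^ 2 j f ⊕ q^ (2 + j) · (f ⊕ (q^ 1 · f ⊕ Σ))                      ≈⟨ ⊕-congˡ {Σq^ 2 j f} (q^-cong (2 + j) (⊕-assoc f _ _)) ⟨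
  Σq^ 2 j f ⊕ q^ (2 + j) · ([1+q^ 1 ]· f ⊕ Σ)                        ∎
  where
  open ≤ₛ-Reasoning
  Σ = Σq^ 2 j f
  top : q^ suc j · Σq^ 2 (suc j) f ≗ q^ (2 + j) · (q^ 1 · f ⊕ Σ)
  top = begin-equality
    q^ suc j · Σq^ 2 (suc j) f                    ≈⟨ q^-cong (suc j) (Σq^-∷ 2 j f) ⟩
    q^ suc j · (q^ 2 · f ⊕ Σq^ 3 j f)             ≈⟨ q^-cong (suc j) (⊕-cong (≗.sym (q^-q^ 1 1 f)) (Σq^-suc 2 j f)) ⟩
    q^ suc j · (q^ 1 · q^ 1 · f ⊕ q^ 1 · Σ)       ≈⟨ q^-cong (suc j) (q^-⊕ 1 _ _) ⟨
    q^ suc j · q^ 1 · (q^ 1 · f ⊕ Σ)              ≈⟨ q^-q^ (suc j) 1 _ ⟩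
    q^ (suc j + 1) · (q^ 1 · f ⊕ Σ)               ≈⟨ index-cong (q^_· (q^ 1 · f ⊕ Σ)) (+-comm (suc j) 1) ⟩
    q^ (2 + j) · (q^ 1 · f ⊕ Σ)                   ∎

atPred : (ℕ → Series) → ℕ → Series
atPred P zero    = 𝟘
atPred P (suc j) = P j

-- the factor Σ_{k<L} q^(2(2k+1)) + Σ_{1≤k<L} q^(2k+1) relating oddHookGF to oddGF
oddHookFactor : ℕ → Op
oddHookFactor zero    f = 𝟘
oddHookFactor (suc k) f = oddHookFactor k f ⊕ q^ suc (k + k) · (q^ suc (k + k) · f ⊕ atPred (λ _ → f) k)

oddHookFactor-isMultiplier : ∀ L → IsMultiplier (oddHookFactor L)
oddHookFactor-isMultiplier zero    = 𝟘-isMultiplier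
oddHookFactor-isMultiplier (suc k) = ⊞-isMultiplier (oddHookFactor-isMultiplier k)
  (∘-isMultiplier (q^-isMultiplier (suc (k + k))) (⊞-isMultiplier (q^-isMultiplier (suc (k + k))) (armTerm k)))
  where
  armTerm : ∀ k → IsMultiplier (λ f → atPred (λ _ → f) k)
  armTerm zero    = 𝟘-isMultiplier
  armTerm (suc k) = id-isMultiplier

-- Sums over partitions

⟦_⟧ : Bool → ℕ
⟦ true  ⟧ = 1
⟦ false ⟧ = 0

⟦∧⟧ : ∀ a b → ⟦ a ∧ b ⟧ ≡ ⟦ a ⟧ * ⟦ b ⟧
⟦∧⟧ true  b = sym (+-identityʳ ⟦ b ⟧)
⟦∧⟧ false b = refl

⟦∧⟧-* : ∀ a b x → ⟦ a ∧ b ⟧ * x ≡ ⟦ b ⟧ * (⟦ a ⟧ * x)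
⟦∧⟧-* a b x = trans (cong (_* x) (trans (⟦∧⟧ a b) (*-comm ⟦ a ⟧ ⟦ b ⟧))) (*-assoc ⟦ b ⟧ ⟦ a ⟧ x)

module _ {A : Set} where

  sum-map-+ : ∀ (g h : A → ℕ) xs → sum (map (λ x → g x + h x) xs) ≡ sum (map g xs) + sum (map h xs)
  sum-map-+ g h []       = refl
  sum-map-+ g h (x ∷ xs) = trans (cong (g x + h x +_) (sum-map-+ g h xs)) (+-interchange (g x) (h x) _ _)

  sum-map-zero : ∀ {g : A → ℕ} xs → (∀ x → g x ≡ 0) → sum (map g xs) ≡ 0
  sum-map-zero []       g≡0 = refl
  sum-map-zero (x ∷ xs) g≡0 = cong₂ _+_ (g≡0 x) (sum-map-zero xs g≡0)

  sum-concatMap : ∀ (G : A → ℕ) (F : ℕ → List A) ks →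
                  sum (map G (concatMap F ks)) ≡ sum (map (λ k → sum (map G (F k))) ks)
  sum-concatMap G F []       = refl
  sum-concatMap G F (k ∷ ks) = begin
    sum (map G (F k ++ concatMap F ks))                   ≡⟨ cong sum (map-++ G (F k) (concatMap F ks)) ⟩
    sum (map G (F k) ++ map G (concatMap F ks))           ≡⟨ sum-++ (map G (F k)) _ ⟩
    sum (map G (F k)) + sum (map G (concatMap F ks))      ≡⟨ cong (sum (map G (F k)) +_) (sum-concatMap G F ks) ⟩
    sum (map G (F k)) + sum (map (λ k → sum (map G (F k))) ks) ∎
    where open ≡-Reasoning

  sum-filter : ∀ (p : A → Bool) (F : A → ℕ) xs → sum (map F (filterᵇ p xs)) ≡ sum (map (λ x → ⟦ p x ⟧ * F x) xs)
  sum-filter p F []       = refl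
  sum-filter p F (x ∷ xs) with p x
  ... | true  = cong₂ _+_ (sym (*-identityˡ (F x))) (sum-filter p F xs)
  ... | false = sum-filter p F xs

  length-filter : ∀ (p : A → Bool) xs → length (filterᵇ p xs) ≡ sum (map (λ x → ⟦ p x ⟧) xs)
  length-filter p []       = refl
  length-filter p (x ∷ xs) with p x
  ... | true  = cong suc (length-filter p xs)
  ... | false = length-filter p xs

sumRange : ℕ → (ℕ → ℕ) → ℕ
sumRange x h = sum (map h (range 1 x))

sumRange-suc : ∀ x h → sumRange (suc x) h ≡ sumRange x h + h (suc x)
sumRange-suc x h = begin
  sum (map h (applyUpTo suc (suc x)))               ≡⟨ cong (sum ∘′ map h) (applyUpTo-∷ʳ suc x) ⟨
  sum (map h (applyUpTo suc x ++ [ suc x ]))        ≡⟨ cong sum (map-++ h (applyUpTo suc x) [ suc x ]) ⟩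
  sum (map h (applyUpTo suc x) ++ [ h (suc x) ])    ≡⟨ sum-++ (map h (applyUpTo suc x)) [ h (suc x) ] ⟩
  sumRange x h + (h (suc x) + 0)                    ≡⟨ cong (sumRange x h +_) (+-identityʳ (h (suc x))) ⟩
  sumRange x h + h (suc x)                          ∎
  where open ≡-Reasoning

sumRange-cong : ∀ x {h h′} → (∀ k → k ≤ x → h k ≡ h′ k) → sumRange x h ≡ sumRange x h′
sumRange-cong zero    h≡h′ = refl
sumRange-cong (suc x) {h} {h′} h≡h′ = begin
  sumRange (suc x) h          ≡⟨ sumRange-suc x h ⟩
  sumRange x h + h (suc x)    ≡⟨ cong₂ _+_ (sumRange-cong x (λ k k≤x → h≡h′ k (m≤n⇒m≤1+n k≤x))) (h≡h′ (suc x) ≤-refl) ⟩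
  sumRange x h′ + h′ (suc x)  ≡⟨ sumRange-suc x h′ ⟨
  sumRange (suc x) h′         ∎
  where open ≡-Reasoning

private
  Σparts : ℕ → ℕ → ℕ → (List ℕ → ℕ) → ℕ
  Σparts f m n G = sum (map G (parts f m n))

  Σparts-suc : ∀ f m n G →
    Σparts (suc f) m (suc n) G ≡ sumRange (m ⊓ suc n) (λ k → Σparts f k (suc n ∸ k) (G ∘ (k ∷_)))
  Σparts-suc f m n G = trans (sum-concatMap G _ (range 1 (m ⊓ suc n)))
    (cong sum (map-cong (λ k → cong sum (sym (map-∘ (parts f k (suc n ∸ k))))) (range 1 (m ⊓ suc n))))

  parts-fuel : ∀ {f f′} m n → n ≤ f → n ≤ f′ → parts f m n ≡ parts f′ m n
  parts-fuel {zero}  {zero}   m zero    _   _    = refl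
  parts-fuel {zero}  {suc f′} m zero    _   _    = refl
  parts-fuel {suc f} {zero}   m zero    _   _    = refl
  parts-fuel {suc f} {suc f′} m zero    _   _    = refl
  parts-fuel {suc f} {suc f′} m (suc n) n<f n<f′ =
    concatMap-cong (λ k → cong (map (k ∷_)) (tail k)) (range 1 (m ⊓ suc n))
    where
    tail : ∀ k → parts f k (suc n ∸ k) ≡ parts f′ k (suc n ∸ k)
    tail zero    = trans (empty f) (sym (empty f′))
      where
      empty : ∀ f → parts f 0 (suc n) ≡ []
      empty zero    = refl
      empty (suc f) = refl
    tail (suc k) = parts-fuel (suc k) (n ∸ k) (≤-trans (m∸n≤m n k) (≤-pred n<f)) (≤-trans (m∸n≤m n k) (≤-pred n<f′))

  Σparts-cong : ∀ f m n {G G′} → (∀ l → All (_≤ m) l → G l ≡ G′ l) → Σparts f m n G ≡ Σparts f m n G′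
  Σparts-cong zero    m zero    G≡G′ = cong (_+ 0) (G≡G′ [] [])
  Σparts-cong (suc f) m zero    G≡G′ = cong (_+ 0) (G≡G′ [] [])
  Σparts-cong zero    m (suc n) G≡G′ = refl
  Σparts-cong (suc f) m (suc n) {G} {G′} G≡G′ = begin
    Σparts (suc f) m (suc n) G                                 ≡⟨ Σparts-suc f m n G ⟩
    sumRange (m ⊓ suc n) (λ k → Σparts f k (suc n ∸ k) (G ∘ (k ∷_)))   ≡⟨ sumRange-cong (m ⊓ suc n) tails ⟩
    sumRange (m ⊓ suc n) (λ k → Σparts f k (suc n ∸ k) (G′ ∘ (k ∷_)))  ≡⟨ Σparts-suc f m n G′ ⟨
    Σparts (suc f) m (suc n) G′                                ∎
    where
    open ≡-Reasoning
    tails : ∀ k → k ≤ m ⊓ suc n → Σparts f k (suc n ∸ k) (G ∘ (k ∷_)) ≡ Σparts f k (suc n ∸ k) (G′ ∘ (k ∷_))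
    tails k k≤ = Σparts-cong f k (suc n ∸ k) λ l l≤k →
      G≡G′ (k ∷ l) (k≤m ∷ All.map (λ x≤k → ≤-trans x≤k k≤m) l≤k)
      where k≤m = ≤-trans k≤ (m⊓n≤m m (suc n))

-- the coefficient of q^n is the sum of G λ over the partitions λ of n with all parts ≤ m
partSum : ℕ → (List ℕ → ℕ) → Series
partSum m G n = Σparts n m n G

partSum-cong : ∀ m {G G′} → (∀ l → All (_≤ m) l → G l ≡ G′ l) → partSum m G ≗ partSum m G′
partSum-cong m G≡G′ n = Σparts-cong n m n G≡G′

partSum-+ : ∀ m G H → partSum m (λ l → G l + H l) ≗ partSum m G ⊕ partSum m H
partSum-+ m G H n = sum-map-+ G H (parts n m n)

partSum-zero : ∀ m {G} → (∀ l → All (_≤ m) l → G l ≡ 0) → partSum m G ≗ 𝟘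
partSum-zero m G≡0 n = trans (partSum-cong m G≡0 n) (sum-map-zero (parts n m n) (λ _ → refl))

partSum-0 : ∀ G n → partSum 0 G n ≡ 𝟙 n * G []
partSum-0 G zero    = trans (+-identityʳ (G [])) (sym (+-identityʳ (G [])))
partSum-0 G (suc n) = refl

partSum-suc : ∀ m G → partSum (suc m) G ≗ partSum m G ⊕ q^ suc m · partSum (suc m) (G ∘ (suc m ∷_))
partSum-suc m G zero    = sym (+-identityʳ _)
partSum-suc m G (suc n) with m ≤? n
... | yes m≤n = begin
  partSum (suc m) G (suc n)                          ≡⟨ Σparts-suc n (suc m) n G ⟩
  sumRange (suc m ⊓ suc n) H                         ≡⟨ cong (λ x → sumRange x H) (m≤n⇒m⊓n≡m (s≤s m≤n)) ⟩
  sumRange (suc m) H                                 ≡⟨ sumRange-suc m H ⟩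
  sumRange m H + H (suc m)                           ≡⟨ cong (λ x → sumRange x H + H (suc m)) (m≤n⇒m⊓n≡m (m≤n⇒m≤1+n m≤n)) ⟨
  sumRange (m ⊓ suc n) H + H (suc m)                 ≡⟨ cong₂ _+_ (Σparts-suc n m n G) top ⟨
  partSum m G (suc n) + (q^ suc m · partSum (suc m) (G ∘ (suc m ∷_))) (suc n)  ∎
  where
  open ≡-Reasoning
  H : ℕ → ℕ
  H k = Σparts n k (suc n ∸ k) (G ∘ (k ∷_))
  top : (q^ suc m · partSum (suc m) (G ∘ (suc m ∷_))) (suc n) ≡ H (suc m)
  top = trans (q^-coeff-≥ (suc m) _ (s≤s m≤n))
              (cong (λ ps → sum (map (G ∘ (suc m ∷_)) ps)) (parts-fuel (suc m) (n ∸ m) ≤-refl (m∸n≤m n m)))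
... | no m≰n = begin
  partSum (suc m) G (suc n)                          ≡⟨ Σparts-suc n (suc m) n G ⟩
  sumRange (suc m ⊓ suc n) H                         ≡⟨ cong (λ x → sumRange x H) (trans (m≥n⇒m⊓n≡n n<m) (sym (m≥n⇒m⊓n≡n (≰⇒> m≰n)))) ⟩
  sumRange (m ⊓ suc n) H                             ≡⟨ Σparts-suc n m n G ⟨
  partSum m G (suc n)                                ≡⟨ +-identityʳ _ ⟨
  partSum m G (suc n) + 0                            ≡⟨ cong (partSum m G (suc n) +_) (q^-coeff-< (suc m) _ (s≤s (≰⇒> m≰n))) ⟨
  partSum m G (suc n) + (q^ suc m · partSum (suc m) (G ∘ (suc m ∷_))) (suc n)  ∎
  where
  open ≡-Reasoning
  n<m = <⇒≤ (s≤s (≰⇒> m≰n))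
  H : ℕ → ℕ
  H k = Σparts n k (suc n ∸ k) (G ∘ (k ∷_))

partSum-coeff-≤ : ∀ m G {n} → n ≤ m → partSum m G n ≡ partSum n G n
partSum-coeff-≤ m G {n} n≤m = go (≤⇒≤′ n≤m)
  where
  go : ∀ {m} → n ≤′ m → partSum m G n ≡ partSum n G n
  go ≤′-refl             = refl
  go (≤′-step {m} n≤′m) = begin
    partSum (suc m) G n                                           ≡⟨ partSum-suc m G n ⟩
    partSum m G n + (q^ suc m · partSum (suc m) (G ∘ (suc m ∷_))) n  ≡⟨ cong (partSum m G n +_) (q^-coeff-< (suc m) _ (s≤s (≤′⇒≤ n≤′m))) ⟩
    partSum m G n + 0                                             ≡⟨ +-identityʳ _ ⟩
    partSum m G n                                                 ≡⟨ go n≤′m ⟩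
    partSum n G n                                                 ∎
    where open ≡-Reasoning

partSum-suc-vanishing : ∀ m {G} → (∀ l → G (suc m ∷ l) ≡ 0) → partSum (suc m) G ≗ partSum m G
partSum-suc-vanishing m {G} G≡0 n = begin
  partSum (suc m) G n                                           ≡⟨ partSum-suc m G n ⟩
  partSum m G n + (q^ suc m · partSum (suc m) (G ∘ (suc m ∷_))) n  ≡⟨ cong (partSum m G n +_) top≡0 ⟩
  partSum m G n + 0                                             ≡⟨ +-identityʳ _ ⟩
  partSum m G n                                                 ∎
  where
  open ≡-Reasoning
  top≡0 = trans (q^-cong (suc m) (partSum-zero (suc m) (λ l _ → G≡0 l)) n) (q^-𝟘 (suc m) n)

partSum-vanishing : ∀ {i m} G → i ≤ m → (∀ k l → i < k → G (k ∷ l) ≡ 0) → partSum m G ≗ partSum i G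
partSum-vanishing {i} G i≤m G≡0 = go (≤⇒≤′ i≤m)
  where
  go : ∀ {m} → i ≤′ m → partSum m G ≗ partSum i G
  go ≤′-refl            = ≗.refl
  go (≤′-step i≤′m) = ≗.trans (partSum-suc-vanishing _ (λ l → G≡0 _ l (s≤s (≤′⇒≤ i≤′m)))) (go i≤′m)

largest≤ : ∀ {M} l → All (_≤ M) l → largest l ≤ M
largest≤ []      []          = z≤n
largest≤ (x ∷ l) (x≤M ∷ _) = x≤M

partSum-largest≤ : ∀ M G n → partSum n (λ l → ⟦ largest l ≤ᵇ M ⟧ * G l) n ≡ partSum M G n
partSum-largest≤ M G n = begin
  partSum n G′ n          ≡⟨ partSum-coeff-≤ (n ⊔ M) G′ (m≤m⊔n n M) ⟨
  partSum (n ⊔ M) G′ n    ≡⟨ partSum-vanishing G′ (m≤n⊔m n M) vanish n ⟩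
  partSum M G′ n          ≡⟨ partSum-cong M keep n ⟩
  partSum M G n           ∎
  where
  open ≡-Reasoning
  G′ : List ℕ → ℕ
  G′ l = ⟦ largest l ≤ᵇ M ⟧ * G l
  vanish : ∀ k l → M < k → G′ (k ∷ l) ≡ 0
  vanish k l M<k with k ≤ᵇ M in k≤ᵇM
  ... | false = refl
  ... | true  = contradiction (≤ᵇ⇒≤ k M (Equivalence.from T-≡ k≤ᵇM)) (<⇒≱ M<k)
  keep : ∀ l → All (_≤ M) l → G′ l ≡ G l
  keep l l≤M = trans (cong (λ b → ⟦ b ⟧ * G l) (Equivalence.to T-≡ (≤⇒≤ᵇ (largest≤ l l≤M)))) (*-identityˡ (G l))

conj-≤ : ∀ {j k} l → j ≤ k → conj (k ∷ l) j ≡ suc (conj l j)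
conj-≤ {j} {k} l j≤k with j ≤ᵇ k | ≤⇒≤ᵇ j≤k
... | true | _ = refl

conj-> : ∀ {j k} l → k < j → conj (k ∷ l) j ≡ conj l j
conj-> {j} {k} l k<j with j ≤ᵇ k in j≤ᵇk
... | false = refl
... | true  = contradiction (≤ᵇ⇒≤ j k (Equivalence.from T-≡ j≤ᵇk)) (<⇒≱ k<j)

conj-below : ∀ {j l} → All (_< j) l → conj l j ≡ 0
conj-below {l = []}    []           = refl
conj-below {l = k ∷ l} (k<j ∷ l<j) = trans (conj-> l k<j) (conj-below l<j)

partSum-conj≡0 : ∀ {i m} G → i ≤ m → partSum m (λ l → ⟦ conj l (suc i) ≡ᵇ 0 ⟧ * G l) ≗ partSum i G
partSum-conj≡0 {i} G i≤m = ≗.trans (partSum-vanishing _ i≤m vanish) (partSum-cong i below)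
  where
  vanish : ∀ k l → i < k → ⟦ conj (k ∷ l) (suc i) ≡ᵇ 0 ⟧ * G (k ∷ l) ≡ 0
  vanish k l i<k = cong (λ c → ⟦ c ≡ᵇ 0 ⟧ * G (k ∷ l)) (conj-≤ l i<k)
  below : ∀ l → All (_≤ i) l → ⟦ conj l (suc i) ≡ᵇ 0 ⟧ * G l ≡ G l
  below l l≤i = trans (cong (λ c → ⟦ c ≡ᵇ 0 ⟧ * G l) (conj-below (All.map s≤s l≤i))) (*-identityˡ (G l))

partSum-conj≡1 : ∀ m G → partSum (suc m) (λ l → ⟦ conj l (suc m) ≡ᵇ 1 ⟧ * G l) ≗ q^ suc m · partSum m (G ∘ (suc m ∷_))
partSum-conj≡1 m G = begin-equality
  partSum (suc m) W                                   ≈⟨ partSum-suc m W ⟩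
  partSum m W ⊕ q^ suc m · partSum (suc m) (W ∘ (suc m ∷_))  ≈⟨ ⊕-cong (partSum-zero m none) (q^-cong (suc m) one) ⟩
  𝟘 ⊕ q^ suc m · partSum m (G ∘ (suc m ∷_))           ∎
  where
  open ≤ₛ-Reasoning
  W : List ℕ → ℕ
  W l = ⟦ conj l (suc m) ≡ᵇ 1 ⟧ * G l
  none : ∀ l → All (_≤ m) l → W l ≡ 0
  none l l≤m = cong (λ c → ⟦ c ≡ᵇ 1 ⟧ * G l) (conj-below (All.map s≤s l≤m))
  one : partSum (suc m) (W ∘ (suc m ∷_)) ≗ partSum m (G ∘ (suc m ∷_))
  one = ≗.trans (partSum-cong (suc m) (λ l _ → cong (λ c → ⟦ c ≡ᵇ 1 ⟧ * G (suc m ∷ l)) (conj-≤ l ≤-refl)))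
                (partSum-conj≡0 (G ∘ (suc m ∷_)) (n≤1+n m))

-- Cells of hook length 2

-- Above rows l, a first row of length k has at most two cells of hook length 2: its last
-- cell (leg 1: exactly one row of l has length k) and the one before (arm 1: no row of l
-- reaches column k - 1).
legHook₂ armHook₂ : ℕ → List ℕ → ℕ
legHook₂ k l = ⟦ conj l k ≡ᵇ 1 ⟧
armHook₂ (suc (suc k)) l = ⟦ conj l (suc k) ≡ᵇ 0 ⟧
armHook₂ _             l = 0

private
  firstRow-sum : ∀ k l → sumRange (suc k) (λ j → ⟦ (suc k ∸ j) + conj l j ≡ᵇ 1 ⟧) ≡ legHook₂ (suc k) l + armHook₂ (suc k) l
  firstRow-sum zero     l = refl
  firstRow-sum (suc k) l = begin
    sumRange (2 + k) ind                              ≡⟨ sumRange-suc (suc k) ind ⟩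
    sumRange (suc k) ind + ind (2 + k)                ≡⟨ cong (_+ ind (2 + k)) (sumRange-suc k ind) ⟩
    sumRange k ind + ind (suc k) + ind (2 + k)        ≡⟨ cong₂ (λ x y → x + y + ind (2 + k)) far near ⟩
    armHook₂ (2 + k) l + ind (2 + k)                  ≡⟨ cong (λ d → armHook₂ (2 + k) l + ⟦ d + conj l (2 + k) ≡ᵇ 1 ⟧) (n∸n≡0 k) ⟩
    armHook₂ (2 + k) l + legHook₂ (2 + k) l           ≡⟨ +-comm _ (legHook₂ (2 + k) l) ⟩
    legHook₂ (2 + k) l + armHook₂ (2 + k) l           ∎
    where
    open ≡-Reasoning
    ind : ℕ → ℕ
    ind j = ⟦ (2 + k ∸ j) + conj l j ≡ᵇ 1 ⟧
    far : sumRange k ind ≡ 0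
    far = trans (sumRange-cong k {h′ = λ _ → 0} λ j j≤k → cong (λ d → ⟦ d + conj l j ≡ᵇ 1 ⟧) (+-∸-assoc 2 j≤k))
                (sum-map-zero (range 1 k) (λ _ → refl))
    near : ind (suc k) ≡ armHook₂ (2 + k) l
    near = cong (λ d → ⟦ d + conj l (suc k) ≡ᵇ 1 ⟧) (m+n∸n≡m 1 k)

  firstRowHook₂ : ∀ k l → length (filterᵇ (λ j → hook (suc k ∷ l) 1 (suc k) j ≡ᵇ 2) (range 1 (suc k)))
                          ≡ legHook₂ (suc k) l + armHook₂ (suc k) l
  firstRowHook₂ k l = begin
    length (filterᵇ (λ j → hook (suc k ∷ l) 1 (suc k) j ≡ᵇ 2) (range 1 (suc k)))
      ≡⟨ length-filter _ (range 1 (suc k)) ⟩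
    sumRange (suc k) (λ j → ⟦ hook (suc k ∷ l) 1 (suc k) j ≡ᵇ 2 ⟧)
      ≡⟨ sumRange-cong (suc k) (λ j j≤k → cong (λ c → ⟦ (suc k ∸ j) + (c ∸ 1) + 1 ≡ᵇ 2 ⟧) (conj-≤ l j≤k)) ⟩
    sumRange (suc k) (λ j → ⟦ (suc k ∸ j) + conj l j + 1 ≡ᵇ 2 ⟧)
      ≡⟨ sumRange-cong (suc k) (λ j _ → cong (λ x → ⟦ x ≡ᵇ 2 ⟧) (+-comm ((suc k ∸ j) + conj l j) 1)) ⟩
    sumRange (suc k) (λ j → ⟦ (suc k ∸ j) + conj l j ≡ᵇ 1 ⟧)
      ≡⟨ firstRow-sum k l ⟩
    legHook₂ (suc k) l + armHook₂ (suc k) l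
      ∎
    where open ≡-Reasoning

  lowerRows : ∀ h k l r i → All (_≤ k) r → cellsCount h (k ∷ l) r (suc i) ≡ cellsCount h l r i
  lowerRows h k l []       i []             = refl
  lowerRows h k l (li ∷ r) i (li≤k ∷ r≤k) = cong₂ _+_ row (lowerRows h k l r (suc i) r≤k)
    where
    row = trans (length-filter _ (range 1 li)) (trans
      (sumRange-cong li (λ j j≤li → cong (λ c → ⟦ (li ∸ j) + (c ∸ suc i) + 1 ≡ᵇ h ⟧) (conj-≤ l (≤-trans j≤li li≤k))))
      (sym (length-filter _ (range 1 li))))

hookCount₂-∷ : ∀ k l → All (_≤ suc k) l → hookCount 2 (suc k ∷ l) ≡ legHook₂ (suc k) l + armHook₂ (suc k) l + hookCount 2 l
hookCount₂-∷ k l l≤k = cong₂ _+_ (firstRowHook₂ k l) (lowerRows 2 (suc k) l l 1 l≤k)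

oddGF oddHookGF distinctGF distinctHookGF : ℕ → Series
oddGF          m = partSum m (λ l → ⟦ all isOdd l ⟧)
oddHookGF      m = partSum m (λ l → ⟦ all isOdd l ⟧ * hookCount 2 l)
distinctGF     m = partSum m (λ l → ⟦ distinctᵇ l ⟧)
distinctHookGF m = partSum m (λ l → ⟦ distinctᵇ l ⟧ * hookCount 2 l)

partSum-armHook₂ : ∀ {m m′} G → m ≤ m′ → partSum m′ (λ l → armHook₂ (suc m) l * G l) ≗ atPred (λ j → partSum j G) m
partSum-armHook₂ {zero}  G _         = partSum-zero _ (λ _ _ → refl)
partSum-armHook₂ {suc j} G sj≤m′ = partSum-conj≡0 G (≤-trans (n≤1+n j) sj≤m′)

partSum-hookCount₂-∷ : ∀ {m m′} (w : List ℕ → ℕ) → m′ ≤ suc m →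
  partSum m′ (λ l → w l * hookCount 2 (suc m ∷ l)) ≗
  partSum m′ (λ l → legHook₂ (suc m) l * w l) ⊕ partSum m′ (λ l → armHook₂ (suc m) l * w l) ⊕ partSum m′ (λ l → w l * hookCount 2 l)
partSum-hookCount₂-∷ {m} {m′} w m′≤ = ≗.trans (partSum-cong m′ split)
  (≗.trans (partSum-+ m′ _ _) (⊕-congʳ (partSum-+ m′ _ _)))
  where
  split : ∀ l → All (_≤ m′) l → w l * hookCount 2 (suc m ∷ l) ≡ legHook₂ (suc m) l * w l + armHook₂ (suc m) l * w l + w l * hookCount 2 l
  split l l≤m′ = begin
    w l * hookCount 2 (suc m ∷ l)                              ≡⟨ cong (w l *_) (hookCount₂-∷ m l (All.map (λ x≤ → ≤-trans x≤ m′≤) l≤m′)) ⟩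
    w l * (legHook₂ (suc m) l + armHook₂ (suc m) l + hookCount 2 l)   ≡⟨ *-distribˡ-+ (w l) _ _ ⟩
    w l * (legHook₂ (suc m) l + armHook₂ (suc m) l) + w l * hookCount 2 l   ≡⟨ cong (_+ w l * hookCount 2 l) (*-distribˡ-+ (w l) _ _) ⟩
    w l * legHook₂ (suc m) l + w l * armHook₂ (suc m) l + w l * hookCount 2 l ≡⟨ cong (λ x → x + w l * hookCount 2 l) (cong₂ _+_ (*-comm (w l) _) (*-comm (w l) _)) ⟩
    legHook₂ (suc m) l * w l + armHook₂ (suc m) l * w l + w l * hookCount 2 l ∎
    where open ≡-Reasoning

oddGF-0 : oddGF 0 ≗ 𝟙
oddGF-0 n = trans (partSum-0 _ n) (*-identityʳ (𝟙 n))

oddHookGF-0 : oddHookGF 0 ≗ 𝟘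
oddHookGF-0 n = trans (partSum-0 _ n) (*-zeroʳ (𝟙 n))

oddGF-even : ∀ m → isOdd (suc m) ≡ false → oddGF (suc m) ≗ oddGF m
oddGF-even m even = partSum-suc-vanishing m λ l → cong (λ b → ⟦ b ∧ all isOdd l ⟧) even

oddHookGF-even : ∀ m → isOdd (suc m) ≡ false → oddHookGF (suc m) ≗ oddHookGF m
oddHookGF-even m even = partSum-suc-vanishing m λ l → cong (λ b → ⟦ b ∧ all isOdd l ⟧ * hookCount 2 (suc m ∷ l)) even

module _ (m : ℕ) (odd : isOdd (suc m) ≡ true) where

  private
    oddTail : partSum (suc m) (λ l → ⟦ all isOdd (suc m ∷ l) ⟧) ≗ oddGF (suc m)
    oddTail = partSum-cong (suc m) λ l _ → cong (λ b → ⟦ b ∧ all isOdd l ⟧) odd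

  oddGF-odd : oddGF (suc m) ≗ [1-q^1+ m ]⁻¹· oddGF m
  oddGF-odd = geom-unique m (≗.trans (partSum-suc m _) (⊕-congˡ (q^-cong (suc m) oddTail)))

  oddHookGF-odd : oddHookGF (suc m) ≗ [1-q^1+ m ]⁻¹· (oddHookGF m ⊕ q^ suc m · (q^ suc m · oddGF m ⊕ atPred oddGF m))
  oddHookGF-odd = geom-unique m (begin-equality
    oddHookGF (suc m)                                            ≈⟨ partSum-suc m _ ⟩
    oddHookGF m ⊕ q^ suc m · partSum (suc m) (λ l → ⟦ all isOdd (suc m ∷ l) ⟧ * hookCount 2 (suc m ∷ l))
      ≈⟨ ⊕-congˡ (q^-cong (suc m) tail) ⟩
    oddHookGF m ⊕ q^ suc m · (q^ suc m · oddGF m ⊕ atPred oddGF m ⊕ oddHookGF (suc m))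
      ≈⟨ ⊕-congˡ (q^-⊕ (suc m) _ _) ⟩
    oddHookGF m ⊕ (q^ suc m · (q^ suc m · oddGF m ⊕ atPred oddGF m) ⊕ q^ suc m · oddHookGF (suc m))
      ≈⟨ ⊕-assoc (oddHookGF m) (q^ suc m · (q^ suc m · oddGF m ⊕ atPred oddGF m)) (q^ suc m · oddHookGF (suc m)) ⟨
    oddHookGF m ⊕ q^ suc m · (q^ suc m · oddGF m ⊕ atPred oddGF m) ⊕ q^ suc m · oddHookGF (suc m) ∎)
    where
    open ≤ₛ-Reasoning
    tail : partSum (suc m) (λ l → ⟦ all isOdd (suc m ∷ l) ⟧ * hookCount 2 (suc m ∷ l)) ≗ q^ suc m · oddGF m ⊕ atPred oddGF m ⊕ oddHookGF (suc m)
    tail = begin-equality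
      partSum (suc m) (λ l → ⟦ all isOdd (suc m ∷ l) ⟧ * hookCount 2 (suc m ∷ l))
        ≈⟨ partSum-cong (suc m) (λ l _ → cong (λ b → ⟦ b ∧ all isOdd l ⟧ * hookCount 2 (suc m ∷ l)) odd) ⟩
      partSum (suc m) (λ l → ⟦ all isOdd l ⟧ * hookCount 2 (suc m ∷ l))
        ≈⟨ partSum-hookCount₂-∷ (λ l → ⟦ all isOdd l ⟧) ≤-refl ⟩
      partSum (suc m) (λ l → legHook₂ (suc m) l * ⟦ all isOdd l ⟧) ⊕ partSum (suc m) (λ l → armHook₂ (suc m) l * ⟦ all isOdd l ⟧) ⊕ oddHookGF (suc m)
        ≈⟨ ⊕-congʳ (⊕-cong leg (partSum-armHook₂ _ (n≤1+n m))) ⟩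
      q^ suc m · oddGF m ⊕ atPred oddGF m ⊕ oddHookGF (suc m) ∎
      where
      leg : partSum (suc m) (λ l → legHook₂ (suc m) l * ⟦ all isOdd l ⟧) ≗ q^ suc m · oddGF m
      leg = ≗.trans (partSum-conj≡1 m _) (q^-cong (suc m) (partSum-cong m λ l _ → cong (λ b → ⟦ b ∧ all isOdd l ⟧) odd))

private
  ≡ᵇ-< : ∀ {m n} → m < n → (n ≡ᵇ m) ≡ false
  ≡ᵇ-< {zero}  {suc n} _         = refl
  ≡ᵇ-< {suc m} {suc n} (s≤s m<n) = ≡ᵇ-< m<n

  any≡ᵇ-conj : ∀ {k} l → All (_≤ k) l → any (k ≡ᵇ_) l ≡ not (conj l k ≡ᵇ 0)
  any≡ᵇ-conj []      []            = refl
  any≡ᵇ-conj {k} (x ∷ l) (x≤k ∷ l≤k) with m≤n⇒m<n∨m≡n x≤k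
  ... | inj₁ x<k = trans (cong (_∨ any (k ≡ᵇ_) l) (≡ᵇ-< x<k))
                         (trans (any≡ᵇ-conj l l≤k) (cong (λ c → not (c ≡ᵇ 0)) (sym (conj-> l x<k))))
  ... | inj₂ refl = trans (cong (_∨ any (k ≡ᵇ_) l) (Equivalence.to T-≡ (≡⇒≡ᵇ k k refl)))
                          (cong (λ c → not (c ≡ᵇ 0)) (sym (conj-≤ {k} l ≤-refl)))

⟦distinctᵇ-∷⟧ : ∀ {k} l → All (_≤ k) l → ⟦ distinctᵇ (k ∷ l) ⟧ ≡ ⟦ conj l k ≡ᵇ 0 ⟧ * ⟦ distinctᵇ l ⟧
⟦distinctᵇ-∷⟧ {k} l l≤k = trans (cong (λ b → ⟦ b ∧ distinctᵇ l ⟧) (trans (cong not (any≡ᵇ-conj l l≤k)) (not-involutive (conj l k ≡ᵇ 0))))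
                                (⟦∧⟧ (conj l k ≡ᵇ 0) (distinctᵇ l))

distinctGF-0 : distinctGF 0 ≗ 𝟙
distinctGF-0 n = trans (partSum-0 _ n) (*-identityʳ (𝟙 n))

distinctHookGF-0 : distinctHookGF 0 ≗ 𝟘
distinctHookGF-0 n = trans (partSum-0 _ n) (*-zeroʳ (𝟙 n))

distinctGF-suc : ∀ m → distinctGF (suc m) ≗ [1+q^ suc m ]· distinctGF m
distinctGF-suc m = ≗.trans (partSum-suc m _) (⊕-congˡ (q^-cong (suc m)
  (≗.trans (partSum-cong (suc m) ⟦distinctᵇ-∷⟧) (partSum-conj≡0 _ (n≤1+n m)))))

distinctHookGF-suc : ∀ m → distinctHookGF (suc m) ≗ distinctHookGF m ⊕ q^ suc m · (atPred distinctGF m ⊕ distinctHookGF m)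
distinctHookGF-suc m = ≗.trans (partSum-suc m _) (⊕-congˡ (q^-cong (suc m) (begin-equality
  partSum (suc m) (λ l → ⟦ distinctᵇ (suc m ∷ l) ⟧ * hookCount 2 (suc m ∷ l))
    ≈⟨ partSum-cong (suc m) split ⟩
  partSum (suc m) (λ l → ⟦ conj l (suc m) ≡ᵇ 0 ⟧ * (⟦ distinctᵇ l ⟧ * hookCount 2 (suc m ∷ l)))
    ≈⟨ partSum-conj≡0 _ (n≤1+n m) ⟩
  partSum m (λ l → ⟦ distinctᵇ l ⟧ * hookCount 2 (suc m ∷ l))
    ≈⟨ partSum-hookCount₂-∷ (λ l → ⟦ distinctᵇ l ⟧) (n≤1+n m) ⟩
  partSum m (λ l → legHook₂ (suc m) l * ⟦ distinctᵇ l ⟧) ⊕ partSum m (λ l → armHook₂ (suc m) l * ⟦ distinctᵇ l ⟧) ⊕ distinctHookGF m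
    ≈⟨ ⊕-congʳ (⊕-cong (partSum-zero m noLeg) (partSum-armHook₂ _ ≤-refl)) ⟩
  𝟘 ⊕ atPred distinctGF m ⊕ distinctHookGF m ∎)))
  where
  open ≤ₛ-Reasoning
  split : ∀ l → All (_≤ suc m) l → ⟦ distinctᵇ (suc m ∷ l) ⟧ * hookCount 2 (suc m ∷ l)
                                   ≡ ⟦ conj l (suc m) ≡ᵇ 0 ⟧ * (⟦ distinctᵇ l ⟧ * hookCount 2 (suc m ∷ l))
  split l l≤m = trans (cong (_* hookCount 2 (suc m ∷ l)) (⟦distinctᵇ-∷⟧ l l≤m)) (*-assoc ⟦ conj l (suc m) ≡ᵇ 0 ⟧ ⟦ distinctᵇ l ⟧ (hookCount 2 (suc m ∷ l)))
  noLeg : ∀ l → All (_≤ m) l → legHook₂ (suc m) l * ⟦ distinctᵇ l ⟧ ≡ 0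
  noLeg l l≤m = cong (λ c → ⟦ c ≡ᵇ 1 ⟧ * ⟦ distinctᵇ l ⟧) (conj-below (All.map s≤s l≤m))

isOdd[2k+1] : ∀ k → isOdd (suc (k + k)) ≡ true
isOdd[2k+1] zero    = refl
isOdd[2k+1] (suc k) = trans (cong (isOdd ∘ suc ∘ suc) (+-suc k k)) (isOdd[2k+1] k)

isOdd[2k+2] : ∀ k → isOdd (suc k + suc k) ≡ false
isOdd[2k+2] zero    = refl
isOdd[2k+2] (suc k) = trans (cong (isOdd ∘ suc) (+-suc (suc k) (suc k))) (isOdd[2k+2] k)

oddGF-double : ∀ l → oddGF (l + l) ≗ ∏[1-q^odd]⁻¹ l 𝟙
oddGF-double zero    = oddGF-0
oddGF-double (suc k) = begin-equality
  oddGF (suc k + suc k)                     ≈⟨ oddGF-even (k + suc k) (isOdd[2k+2] k) ⟩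
  oddGF (k + suc k)                         ≈⟨ index-cong oddGF (+-suc k k) ⟩
  oddGF (suc (k + k))                       ≈⟨ oddGF-odd (k + k) (isOdd[2k+1] k) ⟩
  [1-q^1+ (k + k) ]⁻¹· oddGF (k + k)        ≈⟨ ≗-cong (geom-isMultiplier (k + k)) (oddGF-double k) ⟩
  [1-q^1+ (k + k) ]⁻¹· ∏[1-q^odd]⁻¹ k 𝟙     ∎
  where open ≤ₛ-Reasoning

oddGF-closed : ∀ l → oddGF (suc (l + l)) ≗ ∏[1-q^odd]⁻¹ (suc l) 𝟙
oddGF-closed l = ≗.trans (oddGF-odd (l + l) (isOdd[2k+1] l)) (≗-cong (geom-isMultiplier (l + l)) (oddGF-double l))

atPred-oddGF-double : ∀ l → atPred oddGF (l + l) ≗ atPred (λ _ → ∏[1-q^odd]⁻¹ l 𝟙) l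
atPred-oddGF-double zero    = ≗.refl
atPred-oddGF-double (suc k) = ≗.trans (index-cong oddGF (+-suc k k)) (oddGF-closed k)

oddHookGF-double : ∀ l → oddHookGF (l + l) ≗ oddHookFactor l (∏[1-q^odd]⁻¹ l 𝟙)
oddHookGF-double zero    = oddHookGF-0
oddHookGF-double (suc k) = begin-equality
  oddHookGF (suc k + suc k)                           ≈⟨ oddHookGF-even (k + suc k) (isOdd[2k+2] k) ⟩
  oddHookGF (k + suc k)                               ≈⟨ index-cong oddHookGF (+-suc k k) ⟩
  oddHookGF (suc (k + k))                             ≈⟨ oddHookGF-odd (k + k) (isOdd[2k+1] k) ⟩
  G (oddHookGF (k + k) ⊕ q^ p · (q^ p · oddGF (k + k) ⊕ atPred oddGF (k + k)))
    ≈⟨ ≗-cong (geom-isMultiplier (k + k)) (⊕-cong (oddHookGF-double k) (q^-cong p (⊕-cong (q^-cong p (oddGF-double k)) (atPred-oddGF-double k)))) ⟩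
  G (oddHookFactor (suc k) O)                         ≈⟨ geom-comm (oddHookFactor-isMultiplier (suc k)) (k + k) O ⟨
  oddHookFactor (suc k) (G O)                         ∎
  where
  open ≤ₛ-Reasoning
  p = suc (k + k)
  O = ∏[1-q^odd]⁻¹ k 𝟙
  G = [1-q^1+ (k + k) ]⁻¹·_

oddHookGF-closed : ∀ l → oddHookGF (suc (l + l)) ≗ oddHookFactor (suc l) (∏[1-q^odd]⁻¹ (suc l) 𝟙)
oddHookGF-closed l = begin-equality
  oddHookGF (suc (l + l))        ≈⟨ index-cong oddHookGF (+-suc l l) ⟨
  oddHookGF (l + suc l)          ≈⟨ oddHookGF-even (l + suc l) (isOdd[2k+2] l) ⟨
  oddHookGF (suc l + suc l)      ≈⟨ oddHookGF-double (suc l) ⟩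
  oddHookFactor (suc l) (∏[1-q^odd]⁻¹ (suc l) 𝟙) ∎
  where open ≤ₛ-Reasoning

distinctGF-closed : ∀ m → distinctGF m ≗ ∏[1+q^j] 0 m 𝟙
distinctGF-closed zero    = distinctGF-0
distinctGF-closed (suc m) = ≗.trans (distinctGF-suc m) (≗-cong ([1+q^]-isMultiplier (suc m)) (distinctGF-closed m))

distinctHookGF-1 : distinctHookGF 1 ≗ 𝟘
distinctHookGF-1 = ≗.trans (distinctHookGF-suc 0) (≗.trans (⊕-cong distinctHookGF-0 (q^-cong 1 distinctHookGF-0)) (q^-𝟘 1))

distinctHookGF-closed : ∀ k → distinctHookGF (2 + k) ≗ Σq^ 2 (suc k) (∏[1+q^j] 1 k 𝟙)
distinctHookGF-closed zero = begin-equality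
  distinctHookGF 2                                            ≈⟨ distinctHookGF-suc 1 ⟩
  distinctHookGF 1 ⊕ q^ 2 · (distinctGF 0 ⊕ distinctHookGF 1)  ≈⟨ ⊕-cong distinctHookGF-1 (q^-cong 2 (⊕-cong distinctGF-0 distinctHookGF-1)) ⟩
  𝟘 ⊕ q^ 2 · (𝟙 ⊕ 𝟘)                                          ≈⟨ q^-cong 2 (λ n → +-identityʳ (𝟙 n)) ⟩
  Σq^ 2 1 𝟙                                                   ∎
  where open ≤ₛ-Reasoning
distinctHookGF-closed (suc j) = begin-equality
  distinctHookGF (3 + j)                                                      ≈⟨ distinctHookGF-suc (2 + j) ⟩
  distinctHookGF (2 + j) ⊕ q^ (3 + j) · (distinctGF (suc j) ⊕ distinctHookGF (2 + j))
    ≈⟨ ⊕-cong (distinctHookGF-closed j) (q^-cong (3 + j) (⊕-cong peel (distinctHookGF-closed j))) ⟩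
  Σq^ 2 (suc j) G ⊕ q^ (3 + j) · ([1+q^ 1 ]· G ⊕ Σq^ 2 (suc j) G)              ≈⟨ Σq^₂-[1+q^] (suc j) G ⟨
  Σq^ 2 (2 + j) ([1+q^ (2 + j) ]· G)                                          ∎
  where
  open ≤ₛ-Reasoning
  G = ∏[1+q^j] 1 j 𝟙
  peel : distinctGF (suc j) ≗ [1+q^ 1 ]· G
  peel = ≗.trans (distinctGF-closed (suc j)) (∏[1+q^j]-peel 0 j 𝟙)

Σq^₂≤oddHookFactor : ∀ l G → Σq^ 2 l G ≤ₛ oddHookFactor (suc l) ([1+q^ 1 ]· G)
Σq^₂≤oddHookFactor l G = ≤ₛ-trans (Σq^-mono-length 2 G (≤-trans (m≤m+n l l) (n≤1+n _))) (upTo2l+2 l)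
  where
  open ≤ₛ-Reasoning
  F = [1+q^ 1 ]· G
  G≤F : G ≤ₛ F
  G≤F n = m≤m+n _ _
  upTo2l+2 : ∀ l → Σq^ 2 (suc (l + l)) G ≤ₛ oddHookFactor (suc l) F
  upTo2l+2 zero = begin
    q^ 2 · G                ≈⟨ q^-q^ 1 1 G ⟨
    q^ 1 · q^ 1 · G         ≲⟨ mono (q^-isMultiplier 1) (λ n → ≤-trans (mono (q^-isMultiplier 1) G≤F n) (m≤m+n _ _)) ⟩
    q^ 1 · (q^ 1 · F ⊕ 𝟘)   ∎
  upTo2l+2 (suc k) = begin
    Σq^ 2 (suc (suc k + suc k)) G                          ≈⟨ index-cong (λ e → Σq^ 2 (suc (suc e)) G) (+-suc k k) ⟩
    Σq^ 2 (suc (k + k)) G ⊕ q^ p · G ⊕ q^ suc p · G        ≈⟨ ⊕-assoc (Σq^ 2 (suc (k + k)) G) _ _ ⟩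
    Σq^ 2 (suc (k + k)) G ⊕ (q^ p · G ⊕ q^ suc p · G)      ≈⟨ ⊕-congˡ {Σq^ 2 (suc (k + k)) G} pair ⟨
    Σq^ 2 (suc (k + k)) G ⊕ q^ p · F                       ≲⟨ ⊕-mono (upTo2l+2 k) (mono (q^-isMultiplier p) (λ n → m≤n+m (F n) ((q^ p · F) n))) ⟩
    oddHookFactor (suc k) F ⊕ q^ p · (q^ p · F ⊕ F)        ≈⟨ ⊕-congˡ {oddHookFactor (suc k) F} (index-cong (λ e → q^ e · (q^ e · F ⊕ F)) (cong (suc ∘ suc) (+-suc k k))) ⟨
    oddHookFactor (suc (suc k)) F                          ∎
    where
    p = 3 + (k + k)
    pair : q^ p · F ≗ q^ p · G ⊕ q^ suc p · G
    pair = ≗.trans (q^-⊕ p G (q^ 1 · G)) (⊕-congˡ {q^ p · G} (≗.trans (q^-q^ p 1 G) (index-cong (q^_· G) (+-comm p 1))))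

distinctHookGF≤oddHookGF : ∀ l → distinctHookGF (suc l) ≤ₛ oddHookGF (suc (l + l))
distinctHookGF≤oddHookGF zero    n = ≤-trans (≤-reflexive (distinctHookGF-1 n)) z≤n
distinctHookGF≤oddHookGF (suc k) = begin
  distinctHookGF (2 + k)                                   ≈⟨ distinctHookGF-closed k ⟩
  Σq^ 2 (suc k) G                                          ≲⟨ Σq^₂≤oddHookFactor (suc k) G ⟩
  oddHookFactor (2 + k) ([1+q^ 1 ]· G)                     ≲⟨ mono (oddHookFactor-isMultiplier (2 + k)) distinct≤odd ⟩
  oddHookFactor (2 + k) (∏[1-q^odd]⁻¹ (2 + k) 𝟙)          ≈⟨ oddHookGF-closed (suc k) ⟨
  oddHookGF (suc (suc k + suc k))                          ∎
  where
  open ≤ₛ-Reasoning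
  G = ∏[1+q^j] 1 k 𝟙
  distinct≤odd : [1+q^ 1 ]· G ≤ₛ ∏[1-q^odd]⁻¹ (2 + k) 𝟙
  distinct≤odd = begin
    [1+q^ 1 ]· G              ≈⟨ ∏[1+q^j]-peel 0 k 𝟙 ⟨
    ∏[1+q^j] 0 (suc k) 𝟙      ≲⟨ (λ n → m≤m+n _ _) ⟩
    ∏[1+q^j] 0 (2 + k) 𝟙      ≲⟨ ∏[1+q^j]≤∏[1-q^odd]⁻¹ (2 + k) 𝟙 ⟩
    ∏[1-q^odd]⁻¹ (2 + k) 𝟙    ∎

a₂≡oddHookGF : ∀ L n → a₂ L n ≡ oddHookGF (2 * L ∸ 1) n
a₂≡oddHookGF L n = begin
  a₂ L n                                                                    ≡⟨ sum-filter _ (hookCount 2) (partitions n) ⟩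
  partSum n (λ l → ⟦ all isOdd l ∧ (largest l ≤ᵇ M) ⟧ * hookCount 2 l) n        ≡⟨ partSum-cong n (λ l _ → ⟦∧⟧-* (all isOdd l) _ _) n ⟩
  partSum n (λ l → ⟦ largest l ≤ᵇ M ⟧ * (⟦ all isOdd l ⟧ * hookCount 2 l)) n   ≡⟨ partSum-largest≤ M _ n ⟩
  oddHookGF M n                                                             ∎
  where
  open ≡-Reasoning
  M = 2 * L ∸ 1

b₂≡distinctHookGF : ∀ L n → b₂ L n ≡ distinctHookGF L n
b₂≡distinctHookGF L n = begin
  b₂ L n                                                                     ≡⟨ sum-filter _ (hookCount 2) (partitions n) ⟩
  partSum n (λ l → ⟦ distinctᵇ l ∧ (largest l ≤ᵇ L) ⟧ * hookCount 2 l) n        ≡⟨ partSum-cong n (λ l _ → ⟦∧⟧-* (distinctᵇ l) _ _) n ⟩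
  partSum n (λ l → ⟦ largest l ≤ᵇ L ⟧ * (⟦ distinctᵇ l ⟧ * hookCount 2 l)) n    ≡⟨ partSum-largest≤ L _ n ⟩
  distinctHookGF L n                                                         ∎
  where open ≡-Reasoning

theorem2p3 : (L n : ℕ) → L ≥ 1 → a₂ L n ≥ b₂ L n
theorem2p3 (suc l) n _ = begin
  b₂ (suc l) n                 ≡⟨ b₂≡distinctHookGF (suc l) n ⟩
  distinctHookGF (suc l) n     ≤⟨ distinctHookGF≤oddHookGF l n ⟩
  oddHookGF (suc (l + l)) n    ≡⟨ cong (λ M → oddHookGF M n) 2[1+l]∸1≡1+l+l ⟨
  oddHookGF (2 * suc l ∸ 1) n  ≡⟨ a₂≡oddHookGF (suc l) n ⟨
  a₂ (suc l) n                 ∎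
  where
  open ≤-Reasoning
  2[1+l]∸1≡1+l+l : 2 * suc l ∸ 1 ≡ suc (l + l)
  2[1+l]∸1≡1+l+l = trans (+-suc l (l + 0)) (cong (λ x → suc (l + x)) (+-identityʳ l))
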